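{- Let $G$ and $H$ be connected graphs with $\mathrm{Aut}(G[H])=\mathrm{Aut}(G)[\mathrm{Aut}(H)]$. Then $$D(H)\leq D(G[H])\leq D(H)+M,$$ where $M=\min\{k : \sum_{m=0}^{k} y_m\geq D(G)\}$ and $$y_m=\begin{cases}1 & m=0,\\ D(H) & m=1,\\ D(H)+\sum_{i=1}^{m-1}\binom{m-1}{i}\binom{D(H)}{i+1} & m\geq 2.\end{cases}$$
   Context: All graphs are finite and simple. For a graph $X$, a vertex labeling $\phi:V(X)\to\{1,\dots,r\}$ is $r$-distinguishing if the only automorphism of $X$ preserving all vertex labels is the identity; the distinguishing number $D(X)$ is the least such $r$. The lexicographic product $G[H]$ has vertex set $V(G)\times V(H)$, with $(a,x)$ adjacent to $(b,y)$ iff $ab\in E(G)$, or $a=b$ and $xy\in E(H)$. The wreath product $\mathrm{Aut}(G)[\mathrm{Aut}(H)]$ is the subgroup of $\mathrm{Aut}(G[H])$ consisting of all maps of the form $(g,h)\mapsto(\alpha g,\beta_{g}h)$, where $\alpha\in\mathrm{Aut}(G)$ and, for each $g\in V(G)$, $\beta_g\in\mathrm{Aut}(H)$. -}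

module Defs where

open import Level using (0ℓ)
open import Data.Nat using (ℕ; zero; suc; _+_; _*_; _∸_; _≤_)
open import Data.List using (map; upTo)
open import Data.Nat.ListAction using (sum)
open import Data.Fin.Properties using (*↔×)
open import Function.Properties.Inverse using (↔-trans; ↔-sym)
open import Data.Product.Function.NonDependent.Propositional using (_×-↔_)
open import Data.Nat.Combinatorics using (_C_)
open import Data.Fin using (Fin)
open import Data.Product using (Σ; ∃; _×_; _,_; proj₁; proj₂)
open import Data.Sum using (_⊎_; inj₁; inj₂)
open import Function.Bundles using (_↔_; Inverse; _⇔_)
open import Relation.Binary.PropositionalEquality using (_≡_; refl)
open import Relation.Binary.Construct.Closure.ReflexiveTransitive using (Star)
open import Relation.Nullary using (¬_)

record Graph : Set₁ where
  field
    V     : Set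
    size  : ℕ
    enum  : V ↔ Fin size
    E     : V → V → Set
    sym   : ∀ {u v} → E u v → E v u
    irrefl : ∀ {u} → ¬ E u u
open Graph public

Connected : Graph → Set
Connected X = Σ (V X) (λ _ → ⊤′) × (∀ u v → Star (E X) u v)
  where
    open import Data.Unit using () renaming (⊤ to ⊤′)

record Aut (X : Graph) : Set where
  field
    perm     : V X ↔ V X
    preserves : ∀ u v → E X u v ⇔ E X (Inverse.to perm u) (Inverse.to perm v)
open Aut public

app : ∀ {X} → Aut X → V X → V X
app σ = Inverse.to (perm σ)

-- A labeling with labels {1,…,r} (encoded as Fin r) is r-distinguishing
-- if the only label-preserving automorphism is the identity.
Distinguishing : (X : Graph) (r : ℕ) → (V X → Fin r) → Set
Distinguishing X r φ =
  (σ : Aut X) → (∀ v → φ (app σ v) ≡ φ v) → ∀ v → app σ v ≡ v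

HasDistLabeling : Graph → ℕ → Set
HasDistLabeling X r = Σ (V X → Fin r) (Distinguishing X r)

IsDistinguishingNumber : Graph → ℕ → Set
IsDistinguishingNumber X d =
  HasDistLabeling X d × (∀ r → HasDistLabeling X r → d ≤ r)

LexE : (G H : Graph) → V G × V H → V G × V H → Set
LexE G H (a , x) (b , y) = E G a b ⊎ (a ≡ b × E H x y)

Lex : Graph → Graph → Graph
Lex G H = record
  { V = V G × V H
  ; size = size G * size H
  ; enum = ↔-trans (enum G ×-↔ enum H) (↔-sym *↔×)
  ; E = LexE G H
  ; sym = lex-sym
  ; irrefl = lex-irrefl
  }
  where
    lex-sym : ∀ {u v} → LexE G H u v → LexE G H v u
    lex-sym (inj₁ e) = inj₁ (Graph.sym G e)
    lex-sym (inj₂ (refl , e)) = inj₂ (refl , Graph.sym H e)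
    lex-irrefl : ∀ {u} → ¬ LexE G H u u
    lex-irrefl (inj₁ e) = Graph.irrefl G e
    lex-irrefl (inj₂ (_ , e)) = Graph.irrefl H e

-- Aut(G[H]) = Aut(G)[Aut(H)]: every automorphism of G[H] has the form
-- (g,h) ↦ (α g, β_g h) with α ∈ Aut(G), β_g ∈ Aut(H).  (The reverse
-- inclusion Aut(G)[Aut(H)] ⊆ Aut(G[H]) always holds.)
AutIsWreath : Graph → Graph → Set
AutIsWreath G H =
  (σ : Aut (Lex G H)) →
  Σ (Aut G) λ α → Σ (V G → Aut H) λ β →
    ∀ g h → app σ (g , h) ≡ (app α g , app (β g) h)

-- Σ_{i=a}^{b} f i  (empty if b < a)
sumFromTo : ℕ → ℕ → (ℕ → ℕ) → ℕ
sumFromTo a b f = sum (map (λ j → f (a + j)) (upTo (suc b ∸ a)))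

y : (d : ℕ) → ℕ → ℕ
y d zero = 1
y d (suc zero) = d
y d m@(suc (suc _)) = d + sumFromTo 1 (m ∸ 1) (λ i → ((m ∸ 1) C i) * (d C (suc i)))

IsM : (dG dH : ℕ) → ℕ → Set
IsM dG dH k =
  dG ≤ sumFromTo 0 k (y dH) × (∀ k′ → dG ≤ sumFromTo 0 k′ (y dH) → k ≤ k′)

module Submission where

-- Restricting a distinguishing labeling of G[H] to a single fiber {g₀} × H distinguishes H,
-- because an automorphism of H acting on that fiber alone is a (wreath) automorphism of G[H].
-- For the upper bound take n = D(H) + M labels.  Label the fiber over g by a surjective
-- D(H)-distinguishing labeling of H, pushed into Fin n along a D(H)-subset of Fin n that codes
-- the label of g in a D(G)-distinguishing labeling of G.  An automorphism (α, β) preserving this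
-- labeling maps each fiber onto one with the same set of labels, so α preserves the coded labels
-- of G and is the identity; then each β_g preserves the labels of H and is the identity too.
-- Coding needs D(G) ≤ C(n, D(H)), which is the defining inequality of M since by Vandermonde
-- y_{m+1} = C(m + D(H), m + 1), and then Σ_{m ≤ M} y_m = C(D(H) + M, D(H)) by the hockey stick.

open import Defs hiding (sym)
open import Algebra.Properties.CommutativeSemigroup using (interchange)
open import Data.Fin using (Fin; zero; suc; inject≤; punchOut)
open import Data.Fin.Properties using (suc-injective; +↔⊎; inject≤-injective; punchOut-injective; any?; inj⇒≟)
  renaming (_≟_ to _≟ᶠ_)
open import Data.List using (applyUpTo; _++_; _∷_; [])
open import Data.List.Properties using (map-upTo; applyUpTo-∷ʳ)
open import Data.Nat using (ℕ; zero; suc; _+_; _*_; _∸_; _≤_)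
open import Data.Nat.Combinatorics using (_C_; nC1≡n; nCk≡nC[n∸k]; k>n⇒nCk≡0; nCk+nC[k+1]≡[n+1]C[k+1])
open import Data.Nat.ListAction using (sum)
open import Data.Nat.ListAction.Properties using (sum-++)
open import Data.Nat.Properties
  using (+-comm; +-assoc; +-identityʳ; *-identityˡ; *-distribʳ-+; +-suc; n<1+n; m≤n+m; m+n∸n≡m; 1+n≰n; +-commutativeSemigroup)
open import Data.Product using (∃; _×_; _,_; proj₁; proj₂)
open import Data.Sum using (_⊎_; inj₁; inj₂; [_,_])
open import Data.Sum.Function.Propositional using (_⊎-↔_)
open import Function using (_∘_)
open import Function.Bundles using (_↔_; Inverse; Injection; Equivalence; mk↔ₛ′; mk⇔)
open import Function.Construct.Identity using (↔-id; ⇔-id)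
open import Function.Definitions using (Injective; StrictlySurjective)
open import Function.Properties.Inverse using (↔-trans; ↔-sym; ↔⇒↣)
open import Relation.Binary.Definitions using (DecidableEquality)
open import Relation.Binary.PropositionalEquality using (_≡_; _≢_; refl; sym; trans; cong; cong₂; subst; module ≡-Reasoning)
open import Relation.Nullary using (Dec; yes; no; contradiction)
open import Relation.Nullary.Decidable using (map′)
open import Relation.Unary using (Decidable)

∑ : ℕ → (ℕ → ℕ) → ℕ
∑ n f = sum (applyUpTo f n)

sumFromTo≡∑ : ∀ a b f → sumFromTo a b f ≡ ∑ (suc b ∸ a) (λ i → f (a + i))
sumFromTo≡∑ a b f = cong sum (map-upTo (λ i → f (a + i)) (suc b ∸ a))

∑-cong : ∀ n {f g : ℕ → ℕ} → (∀ i → f i ≡ g i) → ∑ n f ≡ ∑ n g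
∑-cong zero    f≗g = refl
∑-cong (suc n) f≗g = cong₂ _+_ (f≗g 0) (∑-cong n (f≗g ∘ suc))

∑-distrib-+ : ∀ n (f g : ℕ → ℕ) → ∑ n (λ i → f i + g i) ≡ ∑ n f + ∑ n g
∑-distrib-+ zero    f g = refl
∑-distrib-+ (suc n) f g = begin
  f 0 + g 0 + ∑ n (λ i → f (suc i) + g (suc i))  ≡⟨ cong (f 0 + g 0 +_) (∑-distrib-+ n (f ∘ suc) (g ∘ suc)) ⟩
  f 0 + g 0 + (∑ n (f ∘ suc) + ∑ n (g ∘ suc))    ≡⟨ interchange +-commutativeSemigroup (f 0) (g 0) _ _ ⟩
  ∑ (suc n) f + ∑ (suc n) g                       ∎
  where open ≡-Reasoning

∑-last : ∀ n f → ∑ (suc n) f ≡ ∑ n f + f n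
∑-last n f = begin
  sum (applyUpTo f (suc n))       ≡⟨ cong sum (applyUpTo-∷ʳ f n) ⟨
  sum (applyUpTo f n ++ f n ∷ []) ≡⟨ sum-++ (applyUpTo f n) (f n ∷ []) ⟩
  ∑ n f + (f n + 0)               ≡⟨ cong (∑ n f +_) (+-identityʳ (f n)) ⟩
  ∑ n f + f n                     ∎
  where open ≡-Reasoning

vandermonde : ∀ a d j → ∑ (suc a) (λ i → (a C i) * (d C (j + i))) ≡ (a + d) C (j + a)
vandermonde zero    d j = trans (+-identityʳ _) (+-identityʳ _)
vandermonde (suc a) d j = begin
  G 0 + ∑ (suc a) (F ∘ suc)                     ≡⟨ cong (G 0 +_) (∑-cong (suc a) pascal-split) ⟩
  G 0 + ∑ (suc a) (λ i → A i + G (suc i))       ≡⟨ cong (G 0 +_) (∑-distrib-+ (suc a) A (G ∘ suc)) ⟩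
  G 0 + (∑ (suc a) A + ∑ (suc a) (G ∘ suc))     ≡⟨ cong (G 0 +_) (+-comm (∑ (suc a) A) (∑ (suc a) (G ∘ suc))) ⟩
  G 0 + (∑ (suc a) (G ∘ suc) + ∑ (suc a) A)     ≡⟨ +-assoc (G 0) _ _ ⟨
  ∑ (suc (suc a)) G + ∑ (suc a) A               ≡⟨ cong (_+ ∑ (suc a) A) G-last-vanishes ⟩
  ∑ (suc a) G + ∑ (suc a) A                     ≡⟨ cong₂ _+_ (vandermonde a d j) (vandermonde a d (suc j)) ⟩
  (a + d) C (j + a) + (a + d) C suc (j + a)     ≡⟨ nCk+nC[k+1]≡[n+1]C[k+1] (a + d) (j + a) ⟩
  suc (a + d) C suc (j + a)                     ≡⟨ cong (suc (a + d) C_) (+-suc j a) ⟨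
  (suc a + d) C (j + suc a)                     ∎
  where
  open ≡-Reasoning
  F G A : ℕ → ℕ
  F i = (suc a C i) * (d C (j + i))
  G i = (a C i) * (d C (j + i))
  A i = (a C i) * (d C (suc j + i))

  pascal-split : ∀ i → F (suc i) ≡ A i + G (suc i)
  pascal-split i = begin
    (suc a C suc i) * c        ≡⟨ cong (_* c) (nCk+nC[k+1]≡[n+1]C[k+1] a i) ⟨
    (a C i + a C suc i) * c    ≡⟨ *-distribʳ-+ c (a C i) (a C suc i) ⟩
    (a C i) * c + G (suc i)    ≡⟨ cong (λ k → (a C i) * (d C k) + G (suc i)) (+-suc j i) ⟩
    A i + G (suc i)            ∎
    where c = d C (j + suc i)

  G-last-vanishes : ∑ (suc (suc a)) G ≡ ∑ (suc a) G
  G-last-vanishes = begin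
    ∑ (suc (suc a)) G          ≡⟨ ∑-last (suc a) G ⟩
    ∑ (suc a) G + G (suc a)    ≡⟨ cong (λ c → ∑ (suc a) G + c * (d C (j + suc a))) (k>n⇒nCk≡0 (n<1+n a)) ⟩
    ∑ (suc a) G + 0            ≡⟨ +-identityʳ _ ⟩
    ∑ (suc a) G                ∎

y≡C : ∀ d m → y d (suc m) ≡ (m + d) C suc m
y≡C d zero    = sym (nC1≡n d)
y≡C d (suc m) = begin
  y d (suc (suc m))              ≡⟨ cong (d +_) (sumFromTo≡∑ 1 (suc m) term) ⟩
  d + ∑ (suc m) (term ∘ suc)     ≡⟨ cong (_+ ∑ (suc m) (term ∘ suc)) (trans (*-identityˡ (d C 1)) (nC1≡n d)) ⟨
  ∑ (suc (suc m)) term           ≡⟨ vandermonde (suc m) d 1 ⟩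
  (suc m + d) C suc (suc m)      ∎
  where
  open ≡-Reasoning
  term : ℕ → ℕ
  term i = (suc m C i) * (d C suc i)

∑y≡C : ∀ d M → ∑ (suc M) (y d) ≡ (d + M) C M
∑y≡C d zero    = refl
∑y≡C d (suc M) = begin
  ∑ (suc (suc M)) (y d)                   ≡⟨ ∑-last (suc M) (y d) ⟩
  ∑ (suc M) (y d) + y d (suc M)           ≡⟨ cong₂ _+_ (∑y≡C d M) (y≡C d M) ⟩
  (d + M) C M + (M + d) C suc M           ≡⟨ cong (λ n → (d + M) C M + n C suc M) (+-comm M d) ⟩
  (d + M) C M + (d + M) C suc M           ≡⟨ nCk+nC[k+1]≡[n+1]C[k+1] (d + M) M ⟩
  suc (d + M) C suc M                     ≡⟨ cong (_C suc M) (+-suc d M) ⟨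
  (d + suc M) C suc M                     ∎
  where open ≡-Reasoning

sumFromTo-y : ∀ d M → sumFromTo 0 M (y d) ≡ (d + M) C d
sumFromTo-y d M = begin
  sumFromTo 0 M (y d)         ≡⟨ sumFromTo≡∑ 0 M (y d) ⟩
  ∑ (suc M) (y d)             ≡⟨ ∑y≡C d M ⟩
  (d + M) C M                 ≡⟨ nCk≡nC[n∸k] (m≤n+m M d) ⟩
  (d + M) C (d + M ∸ M)       ≡⟨ cong ((d + M) C_) (m+n∸n≡m d M) ⟩
  (d + M) C d                 ∎
  where open ≡-Reasoning

-- Thinning n k: a k-element subset of Fin n, enumerated increasingly by embed.
data Thinning : ℕ → ℕ → Set where
  done : Thinning 0 0
  keep : ∀ {n k} → Thinning n k → Thinning (suc n) (suc k)
  drop : ∀ {n k} → Thinning n k → Thinning (suc n) k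

embed : ∀ {n k} → Thinning n k → Fin k → Fin n
embed (keep s) zero    = zero
embed (keep s) (suc i) = suc (embed s i)
embed (drop s) i       = suc (embed s i)

embed-injective : ∀ {n k} (s : Thinning n k) {i j} → embed s i ≡ embed s j → i ≡ j
embed-injective (keep s) {zero}  {zero}  eq = refl
embed-injective (keep s) {suc i} {suc j} eq = cong suc (embed-injective s (suc-injective eq))
embed-injective (drop s)                 eq = embed-injective s (suc-injective eq)

_⊆_ : ∀ {n k l} → Thinning n k → Thinning n l → Set
s ⊆ t = ∀ i → ∃ λ j → embed t j ≡ embed s i

keep-⊆⁻¹ : ∀ {n k l} {s : Thinning n k} {t : Thinning n l} → keep s ⊆ keep t → s ⊆ t
keep-⊆⁻¹ s⊆t i with s⊆t (suc i)
... | suc j , eq = j , suc-injective eq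

drop-⊆⁻¹ : ∀ {n k l} {s : Thinning n k} {t : Thinning n l} → drop s ⊆ drop t → s ⊆ t
drop-⊆⁻¹ s⊆t i with s⊆t i
... | j , eq = j , suc-injective eq

⊆-antisym : ∀ {n k} {s t : Thinning n k} → s ⊆ t → t ⊆ s → s ≡ t
⊆-antisym {s = done}   {done}   _   _   = refl
⊆-antisym {s = keep s} {keep t} s⊆t t⊆s = cong keep (⊆-antisym (keep-⊆⁻¹ s⊆t) (keep-⊆⁻¹ t⊆s))
⊆-antisym {s = drop s} {drop t} s⊆t t⊆s = cong drop (⊆-antisym (drop-⊆⁻¹ s⊆t) (drop-⊆⁻¹ t⊆s))
⊆-antisym {s = keep s} {drop t} s⊆t _   with s⊆t zero
... | _ , ()
⊆-antisym {s = drop s} {keep t} _   t⊆s with t⊆s zero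
... | _ , ()

drop↔ : ∀ {n} → Thinning (suc n) 0 ↔ Thinning n 0
drop↔ = mk↔ₛ′ (λ { (drop s) → s }) drop (λ _ → refl) (λ { (drop s) → refl })

keep⊎drop↔ : ∀ {n k} → Thinning (suc n) (suc k) ↔ (Thinning n k ⊎ Thinning n (suc k))
keep⊎drop↔ = mk↔ₛ′ split [ keep , drop ]
  (λ { (inj₁ s) → refl ; (inj₂ s) → refl })
  (λ { (keep s) → refl ; (drop s) → refl })
  where
  split : ∀ {n k} → Thinning (suc n) (suc k) → Thinning n k ⊎ Thinning n (suc k)
  split (keep s) = inj₁ s
  split (drop s) = inj₂ s

thinnings↔ : ∀ n k → Thinning n k ↔ Fin (n C k)
thinnings↔ zero    zero    = mk↔ₛ′ (λ _ → zero) (λ _ → done) (λ { zero → refl }) (λ { done → refl })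
thinnings↔ zero    (suc k) = mk↔ₛ′ (λ ()) (λ ()) (λ ()) (λ ())
thinnings↔ (suc n) zero    = ↔-trans drop↔ (thinnings↔ n zero)
thinnings↔ (suc n) (suc k) =
  ↔-trans keep⊎drop↔ (↔-trans (thinnings↔ n k ⊎-↔ thinnings↔ n (suc k))
    (subst (λ m → (Fin (n C k) ⊎ Fin (n C suc k)) ↔ Fin m) (nCk+nC[k+1]≡[n+1]C[k+1] n k) (↔-sym +↔⊎)))

≟-vertex : (X : Graph) → DecidableEquality (V X)
≟-vertex X = inj⇒≟ (↔⇒↣ (enum X))

any-vertex? : (X : Graph) {P : V X → Set} → Decidable P → Dec (∃ P)
any-vertex? X {P} P? =
  map′ (λ (i , p) → from i , p) (λ (v , p) → to v , subst P (sym (strictlyInverseʳ v)) p) (any? (P? ∘ from))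
  where open Inverse (enum X)

idAut : (X : Graph) → Aut X
idAut X = record { perm = ↔-id (V X) ; preserves = λ _ _ → ⇔-id _ }

app-injective : ∀ {X} (σ : Aut X) → Injective _≡_ _≡_ (app σ)
app-injective σ = Injection.injective (↔⇒↣ (perm σ))

wreathAut : (G H : Graph) → Aut G → (V G → Aut H) → Aut (Lex G H)
wreathAut G H α β = record
  { perm      = mk↔ₛ′ to from to∘from from∘to
  ; preserves = λ u v → mk⇔ (forth u v) (back u v)
  }
  where
  module α = Inverse (perm α)
  module β g = Inverse (perm (β g))

  to from : V G × V H → V G × V H
  to   (g , h) = app α g , app (β g) h
  from (g , h) = α.from g , β.from (α.from g) h

  to∘from : ∀ v → to (from v) ≡ v
  to∘from (g , h) = cong₂ _,_ (α.strictlyInverseˡ g) (β.strictlyInverseˡ (α.from g) h)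
  from∘to : ∀ v → from (to v) ≡ v
  from∘to (g , h) rewrite α.strictlyInverseʳ g = cong (g ,_) (β.strictlyInverseʳ g h)

  forth : ∀ u v → LexE G H u v → LexE G H (to u) (to v)
  forth (g , h) (g′ , h′) (inj₁ e)         = inj₁ (Equivalence.to (preserves α g g′) e)
  forth (g , h) (g  , h′) (inj₂ (refl , e)) = inj₂ (refl , Equivalence.to (preserves (β g) h h′) e)
  back : ∀ u v → LexE G H (to u) (to v) → LexE G H u v
  back (g , h) (g′ , h′) (inj₁ e) = inj₁ (Equivalence.from (preserves α g g′) e)
  back (g , h) (g′ , h′) (inj₂ (αg≡αg′ , e)) with app-injective α αg≡αg′
  ... | refl = inj₂ (refl , Equivalence.from (preserves (β g) h h′) e)

restrict-to-fiber : (G H : Graph) → V G → ∀ {r} → HasDistLabeling (Lex G H) r → HasDistLabeling H r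
restrict-to-fiber G H g₀ {r} (Ψ , Ψ-dist) = φ , φ-dist
  where
  φ : V H → Fin r
  φ h = Ψ (g₀ , h)

  only-at-g₀ : Aut H → V G → Aut H
  only-at-g₀ β g with ≟-vertex G g g₀
  ... | yes _ = β
  ... | no  _ = idAut H

  lift : Aut H → Aut (Lex G H)
  lift β = wreathAut G H (idAut G) (only-at-g₀ β)

  lift-fixes : ∀ β → (∀ h → φ (app β h) ≡ φ h) → ∀ v → Ψ (app (lift β) v) ≡ Ψ v
  lift-fixes β β-fixes (g , h) with ≟-vertex G g g₀
  ... | yes refl = β-fixes h
  ... | no  _    = refl

  φ-dist : Distinguishing H r φ
  φ-dist β β-fixes h with ≟-vertex G g₀ g₀ | Ψ-dist (lift β) (lift-fixes β β-fixes) (g₀ , h)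
  ... | yes _    | fixed = cong proj₂ fixed
  ... | no g₀≢g₀ | _     = contradiction refl g₀≢g₀

minimal-labeling-surjective : (X : Graph) {d : ℕ} (φ : V X → Fin d) → Distinguishing X d φ →
  (∀ r → HasDistLabeling X r → d ≤ r) → StrictlySurjective _≡_ φ
minimal-labeling-surjective X {suc d} φ φ-dist φ-min k with any-vertex? X (λ v → φ v ≟ᶠ k)
... | yes hit = hit
... | no  miss = contradiction (φ-min d (φ′ , φ′-dist)) 1+n≰n
  where
  k≢φ : ∀ v → k ≢ φ v
  k≢φ v k≡φv = miss (v , sym k≡φv)
  φ′ : V X → Fin d
  φ′ v = punchOut (k≢φ v)
  φ′-dist : Distinguishing X d φ′
  φ′-dist σ σ-fixes = φ-dist σ (λ v → punchOut-injective (k≢φ (app σ v)) (k≢φ v) (σ-fixes v))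

lexLabeling : ∀ {A B : Set} {n k} → (A → Thinning n k) → (B → Fin k) → A × B → Fin n
lexLabeling S φ (g , h) = embed (S g) (φ h)

lexLabeling-distinguishing : (G H : Graph) → AutIsWreath G H → ∀ {n k}
  (S : V G → Thinning n k) → (∀ α → (∀ g → S (app α g) ≡ S g) → ∀ g → app α g ≡ g) →
  (φ : V H → Fin k) → StrictlySurjective _≡_ φ → Distinguishing H k φ →
  Distinguishing (Lex G H) n (lexLabeling S φ)
lexLabeling-distinguishing G H wreath S S-dist φ φ-onto φ-dist σ σ-fixes (g , h) =
  trans (σ-acts g h) (cong₂ _,_ (α-id g) (β-id g h))
  where
  α : Aut G
  α = proj₁ (wreath σ)
  β : V G → Aut H
  β = proj₁ (proj₂ (wreath σ))
  σ-acts : ∀ g h → app σ (g , h) ≡ (app α g , app (β g) h)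
  σ-acts = proj₂ (proj₂ (wreath σ))

  relabel : ∀ g h → embed (S (app α g)) (φ (app (β g) h)) ≡ embed (S g) (φ h)
  relabel g h = trans (cong (lexLabeling S φ) (sym (σ-acts g h))) (σ-fixes (g , h))

  -- The fibers over g and α g carry the same labels, and a thinning is determined by its image.
  S∘α≡S : ∀ g → S (app α g) ≡ S g
  S∘α≡S g = ⊆-antisym image-shrinks image-grows
    where
    image-shrinks : S (app α g) ⊆ S g
    image-shrinks j with φ-onto j
    ... | h , refl = φ (Inverse.from (perm (β g)) h) , trans (sym (relabel g _))
      (cong (embed (S (app α g)) ∘ φ) (Inverse.strictlyInverseˡ (perm (β g)) h))
    image-grows : S g ⊆ S (app α g)
    image-grows i with φ-onto i
    ... | h , refl = φ (app (β g) h) , relabel g h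

  α-id : ∀ g → app α g ≡ g
  α-id = S-dist α S∘α≡S

  β-id : ∀ g h → app (β g) h ≡ h
  β-id g = φ-dist (β g) λ h →
    embed-injective (S g) (trans (cong (λ s → embed s (φ (app (β g) h))) (sym (S∘α≡S g))) (relabel g h))

lex-upper-bound : (G H : Graph) → AutIsWreath G H → ∀ {dG dH} n →
  HasDistLabeling G dG → IsDistinguishingNumber H dH → dG ≤ n C dH → HasDistLabeling (Lex G H) n
lex-upper-bound G H wreath {dG} {dH} n (c , c-dist) ((φ , φ-dist) , φ-min) dG≤nCdH =
  lexLabeling S φ ,
  lexLabeling-distinguishing G H wreath S S-dist φ (minimal-labeling-surjective H φ φ-dist φ-min) φ-dist
  where
  code : Fin dG → Thinning n dH
  code i = Inverse.from (thinnings↔ n dH) (inject≤ i dG≤nCdH)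
  code-injective : Injective _≡_ _≡_ code
  code-injective = inject≤-injective _ _ _ _ ∘ Injection.injective (↔⇒↣ (↔-sym (thinnings↔ n dH)))
  S : V G → Thinning n dH
  S = code ∘ c
  S-dist : ∀ α → (∀ g → S (app α g) ≡ S g) → ∀ g → app α g ≡ g
  S-dist α S-fixed = c-dist α (code-injective ∘ S-fixed)

theorem2p2 : (G H : Graph) → Connected G → Connected H → AutIsWreath G H →
    (dG dH dGH M : ℕ) →
    IsDistinguishingNumber G dG → IsDistinguishingNumber H dH →
    IsDistinguishingNumber (Lex G H) dGH → IsM dG dH M →
    dH ≤ dGH × dGH ≤ dH + M
theorem2p2 G H ((g₀ , _) , _) _ wreath dG dH dGH M (G-labeling , _) DH (GH-labeling , GH-min) (dG≤∑y , _) =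
  proj₂ DH dGH (restrict-to-fiber G H g₀ GH-labeling) ,
  GH-min (dH + M) (lex-upper-bound G H wreath (dH + M) G-labeling DH dG≤C)
  where
  dG≤C : dG ≤ (dH + M) C dH
  dG≤C = subst (dG ≤_) (sumFromTo-y dH M) dG≤∑y
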